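{- There are no odd primes $x,a,b,c,d$ such that $a=x^4+x^3+x^2+x+1$, $a^2+a+1=(b^2+b+1)(c^2+c+1)(d^2+d+1)$, and $b^2+b+1$, $c^2+c+1$, $d^2+d+1$ are all prime. -}

module Defs where

open import Data.Nat using (ℕ; _+_; _*_)
open import Data.Nat.Primality using (Prime)
open import Data.Product using (_×_)
open import Relation.Binary.PropositionalEquality using (_≢_)

OddPrime : ℕ → Set
OddPrime p = Prime p × p ≢ 2

q : ℕ → ℕ
q y = y * y + y + 1

module Submission where

open import Defs
open import Data.Nat using (ℕ; _+_; _*_; _^_)
open import Data.Nat.Primality using (Prime)
open import Data.Product using (_×_; ∃-syntax)
open import Relation.Binary.PropositionalEquality using (_≡_)
open import Relation.Nullary using (¬_)

open import Data.Nat using (_∸_; pred; zero; suc; _<_; _<ᵇ_; _<?_; _≟_; z<s; s≤s⁻¹)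
open import Data.Nat.Properties
open import Data.Nat.Divisibility using (_∣_; divides; ∣m∣n⇒∣m+n)
open import Data.Nat.Primality using (prime?; euclidsLemma; prime⇒irreducible; prime⇒nonZero; ¬prime[0]; ¬prime[1])
open import Data.Nat.Solver using (module +-*-Solver)
open import Data.List using (List; []; _∷_; upTo)
open import Data.List.Membership.Propositional using (_∈_)
open import Data.List.Membership.DecPropositional _≟_ using (_∈?_)
open import Data.List.Membership.Propositional.Properties using (∈-upTo⁺)
open import Data.List.Relation.Unary.All using (All; []; _∷_; lookup; all?)
open import Data.Product using (_,_)
open import Data.Sum using (_⊎_; inj₁; inj₂)
open import Data.Empty using (⊥-elim)
open import Data.Bool using (T)
open import Relation.Nullary.Decidable using (Dec; yes; no; from-yes; _×-dec_; _→-dec_; ¬?)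
open import Relation.Binary.Definitions using (Monotonic₁; tri<; tri≈; tri>)
open import Relation.Binary.PropositionalEquality using (_≢_; refl; sym; trans; cong; subst; module ≡-Reasoning)

-- Let a = Φ₅(x) = x⁴ + x³ + x² + x + 1.  Then
--     q(a) = q(x - 1) · S(x),    S(x) = x⁶ + 3x⁵ + 5x⁴ + 6x³ + 7x² + 6x + 3,
-- and both factors differ from 1 = q(0).  A product of three primes
-- q(b)·q(c)·q(d) splits into two non-trivial factors only as one of the
-- primes times the product of the other two, so q(x - 1) or S(x) equals one
-- of q(b), q(c), q(d).  Both alternatives are impossible:
--   * q is strictly increasing, hence injective, so q(x - 1) = q(e) forces
--     x - 1 = e; but x - 1 and x cannot both be odd primes;
--   * S(x) is never a value of q.  Since 64·q(e) = 48 + (8e + 4)², for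
--     x ≥ 19 a value S(x) = q(e) would put the square (8e + 4)² strictly
--     between the consecutive squares (7 + T(x))² and (8 + T(x))², where
--     T(x) = 8x³ + 12x² + 11x; for the odd primes x < 19, S(x) lies strictly
--     between explicit consecutive values q(k) < S(x) < q(k + 1).

Φ₅ : ℕ → ℕ
Φ₅ x = x ^ 4 + x ^ 3 + x ^ 2 + x + 1

cofactor : ℕ → ℕ
cofactor x = x ^ 6 + 3 * x ^ 5 + 5 * x ^ 4 + 6 * x ^ 3 + 7 * x ^ 2 + 6 * x + 3

q-Φ₅ : ∀ x → q (Φ₅ x) ≡ q (pred x) * cofactor x
q-Φ₅ zero = refl
q-Φ₅ (suc y) = solve 1 (λ y → let x = con 1 :+ y ; a = x :^ 4 :+ x :^ 3 :+ x :^ 2 :+ x :+ con 1 in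
  a :* a :+ a :+ con 1
    := (y :* y :+ y :+ con 1)
       :* (x :^ 6 :+ con 3 :* x :^ 5 :+ con 5 :* x :^ 4 :+ con 6 :* x :^ 3 :+ con 7 :* x :^ 2 :+ con 6 :* x :+ con 3)) refl y
  where open +-*-Solver

module StrictlyIncreasing {f : ℕ → ℕ} (f-mono : Monotonic₁ _<_ _<_ f) where

  reflects-< : ∀ {m n} → f m < f n → m < n
  reflects-< {m} {n} fm<fn with <-cmp m n
  ... | tri< m<n _ _ = m<n
  ... | tri≈ _ refl _ = ⊥-elim (<-irrefl refl fm<fn)
  ... | tri> _ _ n<m = ⊥-elim (<-asym fm<fn (f-mono n<m))

  injective : ∀ {m n} → f m ≡ f n → m ≡ n
  injective {m} {n} fm≡fn with <-cmp m n
  ... | tri< m<n _ _ = ⊥-elim (<-irrefl fm≡fn (f-mono m<n))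
  ... | tri≈ _ m≡n _ = m≡n
  ... | tri> _ _ n<m = ⊥-elim (<-irrefl (sym fm≡fn) (f-mono n<m))

  gap : ∀ {k n} → f k < n → n < f (suc k) → ∀ e → n ≢ f e
  gap lower upper e refl = <⇒≱ (reflects-< lower) (s≤s⁻¹ (reflects-< upper))

q-increasing : Monotonic₁ _<_ _<_ q
q-increasing m<n = +-monoˡ-< 1 (+-mono-< (*-mono-< m<n m<n) m<n)

open StrictlyIncreasing q-increasing using () renaming (injective to q-injective; gap to q-gap)

q-gap-by-evaluation : ∀ {n} k → {T (q k <ᵇ n)} → {T (n <ᵇ q (suc k))} → ∀ e → n ≢ q e
q-gap-by-evaluation {n} k {lower} {upper} = q-gap (<ᵇ⇒< (q k) n lower) (<ᵇ⇒< n (q (suc k)) upper)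

split-prime : ∀ {p} u v {m} → Prime p → u * v ≡ p * m →
              (∃[ u′ ] u ≡ p * u′ × u′ * v ≡ m) ⊎ (∃[ v′ ] v ≡ p * v′ × u * v′ ≡ m)
split-prime {p} u v {m} pp uv≡pm with euclidsLemma u v pp (divides m (trans uv≡pm (*-comm p m)))
... | inj₁ (divides u′ u≡u′p) = inj₁ (u′ , u≡pu′ , cancel-p (begin
        p * (u′ * v) ≡⟨ *-assoc p u′ v ⟨
        p * u′ * v   ≡⟨ cong (_* v) u≡pu′ ⟨
        u * v        ≡⟨ uv≡pm ⟩
        p * m        ∎))
  where
  open ≡-Reasoning
  u≡pu′ = trans u≡u′p (*-comm u′ p)
  cancel-p = *-cancelˡ-≡ _ _ p {{prime⇒nonZero pp}}
... | inj₂ (divides v′ v≡v′p) = inj₂ (v′ , v≡pv′ , cancel-p (begin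
        p * (u * v′) ≡⟨ *-assoc p u v′ ⟨
        p * u * v′   ≡⟨ cong (_* v′) (*-comm p u) ⟩
        u * p * v′   ≡⟨ *-assoc u p v′ ⟩
        u * (p * v′) ≡⟨ cong (u *_) v≡pv′ ⟨
        u * v        ≡⟨ uv≡pm ⟩
        p * m        ∎))
  where
  open ≡-Reasoning
  v≡pv′ = trans v≡v′p (*-comm v′ p)
  cancel-p = *-cancelˡ-≡ _ _ p {{prime⇒nonZero pp}}

factors-of-prime : ∀ {p} u v → Prime p → u * v ≡ p → u ≡ 1 ⊎ v ≡ 1
factors-of-prime {p} u v pp uv≡p with split-prime u v pp (trans uv≡p (sym (*-identityʳ p)))
... | inj₁ (u′ , _ , u′v≡1) = inj₂ (m*n≡1⇒n≡1 u′ v u′v≡1)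
... | inj₂ (v′ , _ , uv′≡1) = inj₁ (m*n≡1⇒m≡1 u v′ uv′≡1)

factors-of-two-primes : ∀ {p r} u v → Prime p → Prime r → u * v ≡ p * r →
                        u ≡ 1 ⊎ v ≡ 1 ⊎ (u ≡ p × v ≡ r) ⊎ (u ≡ r × v ≡ p)
factors-of-two-primes {p} u v pp pr uv≡pr with split-prime u v pp uv≡pr
... | inj₁ (u′ , u≡pu′ , u′v≡r) with factors-of-prime u′ v pr u′v≡r
...   | inj₁ refl = inj₂ (inj₂ (inj₁ (trans u≡pu′ (*-identityʳ p) , trans (sym (*-identityˡ v)) u′v≡r)))
...   | inj₂ v≡1 = inj₂ (inj₁ v≡1)
factors-of-two-primes {p} u v pp pr uv≡pr | inj₂ (v′ , v≡pv′ , uv′≡r) with factors-of-prime u v′ pr uv′≡r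
...   | inj₁ u≡1 = inj₁ u≡1
...   | inj₂ refl = inj₂ (inj₂ (inj₂ (trans (sym (*-identityʳ u)) uv′≡r , trans v≡pv′ (*-identityʳ p))))

OneOf : ℕ → ℕ → ℕ → ℕ → Set
OneOf p r s n = n ≡ p ⊎ n ≡ r ⊎ n ≡ s

factors-of-three-primes : ∀ {p r s} u v → Prime p → Prime r → Prime s →
                          u * v ≡ p * r * s → u ≢ 1 → v ≢ 1 → OneOf p r s u ⊎ OneOf p r s v
factors-of-three-primes {p} {r} {s} u v pp pr ps uv≡prs u≢1 v≢1
  with split-prime u v pp (trans uv≡prs (*-assoc p r s))
... | inj₁ (u′ , u≡pu′ , u′v≡rs) with factors-of-two-primes u′ v pr ps u′v≡rs
...   | inj₁ refl = inj₁ (inj₁ (trans u≡pu′ (*-identityʳ p)))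
...   | inj₂ (inj₁ v≡1) = ⊥-elim (v≢1 v≡1)
...   | inj₂ (inj₂ (inj₁ (_ , v≡s))) = inj₂ (inj₂ (inj₂ v≡s))
...   | inj₂ (inj₂ (inj₂ (_ , v≡r))) = inj₂ (inj₂ (inj₁ v≡r))
factors-of-three-primes u v pp pr ps uv≡prs u≢1 v≢1 | inj₂ (v′ , v≡pv′ , uv′≡rs)
  with factors-of-two-primes u v′ pr ps uv′≡rs
...   | inj₁ u≡1 = ⊥-elim (u≢1 u≡1)
...   | inj₂ (inj₁ refl) = inj₂ (inj₁ (trans v≡pv′ (*-identityʳ _)))
...   | inj₂ (inj₂ (inj₁ (u≡r , _))) = inj₁ (inj₂ (inj₁ u≡r))
...   | inj₂ (inj₂ (inj₂ (u≡s , _))) = inj₁ (inj₂ (inj₂ u≡s))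

2∣n⊎2∣1+n : ∀ n → 2 ∣ n ⊎ 2 ∣ suc n
2∣n⊎2∣1+n zero = inj₁ (divides 0 refl)
2∣n⊎2∣1+n (suc n) with 2∣n⊎2∣1+n n
... | inj₁ 2∣n = inj₂ (∣m∣n⇒∣m+n (divides 1 refl) 2∣n)
... | inj₂ 2∣1+n = inj₁ 2∣1+n

odd-prime-is-odd : ∀ {p} → OddPrime p → ¬ 2 ∣ p
odd-prime-is-odd (pp , p≢2) 2∣p with prime⇒irreducible pp 2∣p
... | inj₁ ()
... | inj₂ 2≡p = p≢2 (sym 2≡p)

consecutive-odd-primes : ∀ {y} → OddPrime y → ¬ OddPrime (suc y)
consecutive-odd-primes {y} oy oy+1 with 2∣n⊎2∣1+n y
... | inj₁ 2∣y = odd-prime-is-odd oy 2∣y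
... | inj₂ 2∣y+1 = odd-prime-is-odd oy+1 2∣y+1

-- For x an odd prime, q(x - 1) is not q of any odd prime, as x - 1 is even.
q-pred-not-q-of-odd-prime : ∀ {x} → OddPrime x → ∀ e → OddPrime e → q (pred x) ≢ q e
q-pred-not-q-of-odd-prime {zero} (p0 , _) = ⊥-elim (¬prime[0] p0)
q-pred-not-q-of-odd-prime {suc y} ox e oe qy≡qe =
  consecutive-odd-primes (subst OddPrime (sym (q-injective {y} {e} qy≡qe)) oe) ox

q-pred≢1 : ∀ {x} → OddPrime x → q (pred x) ≢ 1
q-pred≢1 {zero} (p0 , _) = ⊥-elim (¬prime[0] p0)
q-pred≢1 {suc y} (px , _) qy≡1 = ¬prime[1] (subst (λ n → Prime (suc n)) (q-injective {y} {0} qy≡1) px)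

-- The polynomial T(x) of the proof idea: for x ≥ 19, 8·√S(x) lies between
-- 7 + cubic x and 8 + cubic x.
cubic : ℕ → ℕ
cubic x = 8 * x ^ 3 + 12 * x ^ 2 + 11 * x

q-scaled : ∀ e → 64 * q e ≡ 48 + (8 * e + 4) ^ 2
q-scaled = solve 1 (λ e → con 64 :* (e :* e :+ e :+ con 1) := con 48 :+ (con 8 :* e :+ con 4) :^ 2) refl
  where open +-*-Solver

<-of-≡+suc : ∀ {m n} k → n ≡ m + suc k → m < n
<-of-≡+suc {m} k n≡m+k = subst (m <_) (sym n≡m+k) (m<m+n m z<s)

cofactor-above : ∀ x → 48 + (7 + cubic x) ^ 2 < 64 * cofactor x
cofactor-above x = <-of-≡+suc (8 * x ^ 3 + 159 * x ^ 2 + 230 * x + 94) (identity x)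
  where
  open +-*-Solver
  identity : ∀ x → 64 * cofactor x ≡ 48 + (7 + cubic x) ^ 2 + suc (8 * x ^ 3 + 159 * x ^ 2 + 230 * x + 94)
  identity = solve 1 (λ x →
    con 64 :* (x :^ 6 :+ con 3 :* x :^ 5 :+ con 5 :* x :^ 4 :+ con 6 :* x :^ 3 :+ con 7 :* x :^ 2 :+ con 6 :* x :+ con 3)
      := con 48 :+ (con 7 :+ (con 8 :* x :^ 3 :+ con 12 :* x :^ 2 :+ con 11 :* x)) :^ 2
         :+ (con 1 :+ (con 8 :* x :^ 3 :+ con 159 :* x :^ 2 :+ con 230 :* x :+ con 94))) refl

cofactor-below : ∀ z → 64 * cofactor (19 + z) < 48 + (8 + cubic (19 + z)) ^ 2
cofactor-below z = <-of-≡+suc (8 * z ^ 3 + 321 * z ^ 2 + 3326 * z + 2104) (identity z)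
  where
  open +-*-Solver
  identity : ∀ z → 48 + (8 + cubic (19 + z)) ^ 2 ≡ 64 * cofactor (19 + z) + suc (8 * z ^ 3 + 321 * z ^ 2 + 3326 * z + 2104)
  identity = solve 1 (λ z → let x = con 19 :+ z in
    con 48 :+ (con 8 :+ (con 8 :* x :^ 3 :+ con 12 :* x :^ 2 :+ con 11 :* x)) :^ 2
      := con 64 :* (x :^ 6 :+ con 3 :* x :^ 5 :+ con 5 :* x :^ 4 :+ con 6 :* x :^ 3 :+ con 7 :* x :^ 2 :+ con 6 :* x :+ con 3)
         :+ (con 1 :+ (con 8 :* z :^ 3 :+ con 321 :* z :^ 2 :+ con 3326 :* z :+ con 2104))) refl

-- For x ≥ 19, S(x) = q(e) would put (8e + 4)² strictly between the
-- consecutive squares (7 + cubic x)² and (8 + cubic x)².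
large-cofactor-not-q : ∀ z e → cofactor (19 + z) ≢ q e
large-cofactor-not-q z e S≡qe = gap {k = 7 + cubic x} lower upper (8 * e + 4) refl
  where
  open StrictlyIncreasing (^-monoˡ-< 2) using (gap)
  x = 19 + z
  64S≡48+square : 64 * cofactor x ≡ 48 + (8 * e + 4) ^ 2
  64S≡48+square = trans (cong (64 *_) S≡qe) (q-scaled e)
  lower : (7 + cubic x) ^ 2 < (8 * e + 4) ^ 2
  lower = +-cancelˡ-< 48 ((7 + cubic x) ^ 2) ((8 * e + 4) ^ 2)
            (subst (48 + (7 + cubic x) ^ 2 <_) 64S≡48+square (cofactor-above x))
  upper : (8 * e + 4) ^ 2 < (8 + cubic x) ^ 2
  upper = +-cancelˡ-< 48 ((8 * e + 4) ^ 2) ((8 + cubic x) ^ 2)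
            (subst (_< 48 + (8 + cubic x) ^ 2) 64S≡48+square (cofactor-below z))

small-odd-primes : List ℕ
small-odd-primes = 3 ∷ 5 ∷ 7 ∷ 11 ∷ 13 ∷ 17 ∷ []

odd-primes-below-19 : All (λ x → OddPrime x → x ∈ small-odd-primes) (upTo 19)
odd-primes-below-19 = from-yes (all? (λ x → odd-prime? x →-dec (x ∈? small-odd-primes)) (upTo 19))
  where
  odd-prime? : ∀ n → Dec (OddPrime n)
  odd-prime? n = prime? n ×-dec ¬? (n ≟ 2)

-- For each odd prime x < 19, S(x) lies strictly between q(k) and q(k + 1).
small-cofactors-not-q : All (λ x → ∀ e → cofactor x ≢ q e) small-odd-primes
small-cofactors-not-q = q-gap-by-evaluation 45 ∷ q-gap-by-evaluation 170 ∷ q-gap-by-evaluation 426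
                      ∷ q-gap-by-evaluation 1528 ∷ q-gap-by-evaluation 2468 ∷ q-gap-by-evaluation 5370 ∷ []

small-cofactor-not-q : ∀ {x} → x < 19 → OddPrime x → ∀ e → cofactor x ≢ q e
small-cofactor-not-q x<19 ox =
  lookup {P = λ x → ∀ e → cofactor x ≢ q e} small-cofactors-not-q
    (lookup {P = λ x → OddPrime x → x ∈ small-odd-primes} odd-primes-below-19 (∈-upTo⁺ x<19) ox)

cofactor-not-q : ∀ {x} → OddPrime x → ∀ e → cofactor x ≢ q e
cofactor-not-q {x} ox with x <? 19
... | yes x<19 = small-cofactor-not-q x<19 ox
... | no x≮19 = subst (λ n → ∀ e → cofactor n ≢ q e) (m+[n∸m]≡n (≮⇒≥ x≮19)) (large-cofactor-not-q (x ∸ 19))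

not-OneOf-q : ∀ {n b c d} → (∀ e → OddPrime e → n ≢ q e) →
              OddPrime b → OddPrime c → OddPrime d → ¬ OneOf (q b) (q c) (q d) n
not-OneOf-q n≢q ob oc od (inj₁ n≡qb) = n≢q _ ob n≡qb
not-OneOf-q n≢q ob oc od (inj₂ (inj₁ n≡qc)) = n≢q _ oc n≡qc
not-OneOf-q n≢q ob oc od (inj₂ (inj₂ n≡qd)) = n≢q _ od n≡qd

lemma8 : ¬ (∃[ x ] ∃[ a ] ∃[ b ] ∃[ c ] ∃[ d ] (OddPrime x × OddPrime a × OddPrime b × OddPrime c × OddPrime d × a ≡ x ^ 4 + x ^ 3 + x ^ 2 + x + 1 × q a ≡ q b * q c * q d × Prime (q b) × Prime (q c) × Prime (q d)))
lemma8 (x , _ , b , c , d , ox , _ , ob , oc , od , a≡Φ₅x , qa≡product , pb , pc , pd)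
  with factors-of-three-primes (q (pred x)) (cofactor x) pb pc pd
         (trans (sym (q-Φ₅ x)) (trans (cong q (sym a≡Φ₅x)) qa≡product)) (q-pred≢1 ox) (cofactor-not-q ox 0)
... | inj₁ qpredx∈ = not-OneOf-q (q-pred-not-q-of-odd-prime ox) ob oc od qpredx∈
... | inj₂ S∈ = not-OneOf-q (λ e _ → cofactor-not-q ox e) ob oc od S∈
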